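{- For $n\ge 1$, let $c_n$ be the number of tilings by unit squares and dominoes of the region obtained from the $(2\times n)$-board by removing the lower cell of its last column, and set $c_0=0$. Then $$c_n=3c_{n-1}+c_{n-2}-c_{n-3}\qquad\text{for all } n\ge 3.$$
   Context: The $(2\times n)$-board is the rectangle $[0,n]\times[0,2]$ subdivided into $2n$ unit cells. A domino is the union of two cells sharing an edge and may be horizontal or vertical. The region counted by $c_n$ consists of the cells $[i-1,i]\times[0,1]$ for $1\le i\le n-1$ and $[i-1,i]\times[1,2]$ for $1\le i\le n$. For example, $c_1=1$, $c_2=3$ and $c_3=10$. -}

module Defs where

open import Data.Nat using (ℕ; zero; suc)
open import Data.Bool using (Bool; true; false; _∧_)
open import Data.Maybe using (Maybe; just; nothing)
open import Data.Vec using (Vec; []; _∷_)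
open import Data.List using (List; []; _∷_; [_]; map; concatMap; length; filterᵇ; cartesianProduct)
open import Data.Product using (_×_; _,_)
open import Relation.Binary.PropositionalEquality using (_≡_; refl)

-- Encoding of a tiling of a region by unit squares and dominoes:
-- every cell of the region is labelled by where its tile continues.
--   sq : the cell is covered by a unit square
--   rt / lt / up / dn : the cell is covered by a domino whose other cell is
--   the neighbour to the right / left / above / below.
-- A labelling is a tiling iff every domino label points to a cell of the
-- region carrying the opposite label (so each domino is counted by its two cells).
data Dir : Set where
  sq rt lt up dn : Dir

_==_ : Dir → Dir → Bool
sq == sq = true
rt == rt = true
lt == lt = true
up == up = true
dn == dn = true
_ == _ = false

-- label at position i of a row (nothing = no cell of the region there)
at : ∀ {k} → Vec Dir k → ℕ → Maybe Dir
at [] _ = nothing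
at (x ∷ _) zero = just x
at (_ ∷ xs) (suc i) = at xs i

is : Maybe Dir → Dir → Bool
is nothing _ = false
is (just x) d = x == d

-- Region for n = suc m columns:
--   top row    : cells [i-1,i]×[1,2], 1 ≤ i ≤ suc m  (a Vec of length suc m)
--   bottom row : cells [i-1,i]×[0,1], 1 ≤ i ≤ m      (a Vec of length m)
-- Column index is 0-based below.

topOK : ∀ {k l} → Vec Dir k → Vec Dir l → ℕ → Dir → Bool
topOK t b i sq = true
topOK t b i rt = is (at t (suc i)) lt
topOK t b zero lt = false
topOK t b (suc j) lt = is (at t j) rt
topOK t b i dn = is (at b i) up
topOK t b i up = false

botOK : ∀ {k l} → Vec Dir k → Vec Dir l → ℕ → Dir → Bool
botOK t b i sq = true
botOK t b i rt = is (at b (suc i)) lt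
botOK t b zero lt = false
botOK t b (suc j) lt = is (at b j) rt
botOK t b i up = is (at t i) dn
botOK t b i dn = false

checkRow : ∀ {k} → (ℕ → Dir → Bool) → ℕ → Vec Dir k → Bool
checkRow ok i [] = true
checkRow ok i (x ∷ xs) = ok i x ∧ checkRow ok (suc i) xs

isTiling : ∀ {k l} → Vec Dir k × Vec Dir l → Bool
isTiling (t , b) = checkRow (topOK t b) 0 t ∧ checkRow (botOK t b) 0 b

allDirs : List Dir
allDirs = sq ∷ rt ∷ lt ∷ up ∷ dn ∷ []

allVecs : (k : ℕ) → List (Vec Dir k)
allVecs zero = [ [] ]
allVecs (suc k) = concatMap (λ d → map (d ∷_) (allVecs k)) allDirs

c : ℕ → ℕ
c zero = 0
c (suc m) = length (filterᵇ isTiling (cartesianProduct (allVecs (suc m)) (allVecs m)))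

c1 : c 1 ≡ 1
c1 = refl
c2 : c 2 ≡ 3
c2 = refl
c3 : c 3 ≡ 10
c3 = refl

-- Let tilings P Q m count the tilings of the region of c (m + 1) in which
-- a horizontal domino enters the first top cell (P) and/or the first bottom cell (Q) from the
-- left.  Removing the first column expresses these four counts a, b, d, e (for the flags
-- ff, tf, ft, tt) at m + 1 through those at m: a′ = 2a + b + d + e, b′ = a + d, d′ = a + b,
-- e′ = a.  Since c (m + 1) = a m and c m = e m, eliminating b, d, e from two steps of this
-- recurrence gives c (m + 3) + c m = 3 c (m + 2) + c (m + 1).

module Submission where

open import Defs
open import Algebra.Bundles using (CommutativeMonoid)
open import Data.Bool using (Bool; true; false; _∧_)
open import Data.Bool.Properties using (∧-commutativeMonoid)
open import Data.List using (List; []; _∷_; _++_; map; concatMap; length; filterᵇ; cartesianProduct)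
open import Data.Nat using (ℕ; zero; suc; _+_; _*_; _∸_; _≤_; s≤s)
open import Data.Nat.Properties
  using (+-assoc; +-identityʳ; *-identityˡ; *-zeroʳ; *-distribˡ-+; n≤1+n; ≤-refl; ≤-trans)
open import Data.Nat.Tactic.RingSolver using (solve-∀)
open import Data.Product using (_×_; _,_; uncurry)
open import Data.Vec using (Vec; []; _∷_)
open import Function using (_∘_)
open import Relation.Binary.PropositionalEquality
  using (_≡_; refl; sym; trans; cong; cong₂; module ≡-Reasoning)

open import Algebra.Properties.CommutativeSemigroup
  (CommutativeMonoid.commutativeSemigroup ∧-commutativeMonoid) using (interchange)

private
  variable
    A B : Set
    k l n : ℕ

∑ : List A → (A → ℕ) → ℕ
∑ []       f = 0
∑ (x ∷ xs) f = f x + ∑ xs f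

infix 5 ∑
syntax ∑ xs (λ x → e) = ∑[ x ∈ xs ] e

∑-cong : ∀ (xs : List A) {f g : A → ℕ} → (∀ x → f x ≡ g x) → ∑ xs f ≡ ∑ xs g
∑-cong []       f≡g = refl
∑-cong (x ∷ xs) f≡g = cong₂ _+_ (f≡g x) (∑-cong xs f≡g)

∑-++ : ∀ (xs ys : List A) (f : A → ℕ) → ∑ (xs ++ ys) f ≡ ∑ xs f + ∑ ys f
∑-++ []       ys f = refl
∑-++ (x ∷ xs) ys f = trans (cong (f x +_) (∑-++ xs ys f)) (sym (+-assoc (f x) _ _))

∑-map : ∀ (h : A → B) (xs : List A) (f : B → ℕ) → ∑ (map h xs) f ≡ ∑ xs (f ∘ h)
∑-map h []       f = refl
∑-map h (x ∷ xs) f = cong (f (h x) +_) (∑-map h xs f)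

∑-concatMap : ∀ (h : A → List B) (xs : List A) (f : B → ℕ) →
              ∑ (concatMap h xs) f ≡ ∑[ x ∈ xs ] ∑ (h x) f
∑-concatMap h []       f = refl
∑-concatMap h (x ∷ xs) f =
  trans (∑-++ (h x) (concatMap h xs) f) (cong (∑ (h x) f +_) (∑-concatMap h xs f))

∑-cartesianProduct : ∀ (xs : List A) (ys : List B) (f : A × B → ℕ) →
                     ∑ (cartesianProduct xs ys) f ≡ ∑[ x ∈ xs ] ∑[ y ∈ ys ] f (x , y)
∑-cartesianProduct []       ys f = refl
∑-cartesianProduct (x ∷ xs) ys f =
  trans (∑-++ (map (x ,_) ys) _ f)
        (cong₂ _+_ (∑-map (x ,_) ys f) (∑-cartesianProduct xs ys f))

∑-*ˡ : ∀ (xs : List A) k (f : A → ℕ) → ∑[ x ∈ xs ] k * f x ≡ k * ∑ xs f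
∑-*ˡ []       k f = sym (*-zeroʳ k)
∑-*ˡ (x ∷ xs) k f = trans (cong (k * f x +_) (∑-*ˡ xs k f)) (sym (*-distribˡ-+ k (f x) _))

∑-+ : ∀ (xs : List A) (f g : A → ℕ) → ∑[ x ∈ xs ] (f x + g x) ≡ ∑ xs f + ∑ xs g
∑-+ []       f g = refl
∑-+ (x ∷ xs) f g = trans (cong (f x + g x +_) (∑-+ xs f g)) (+-interchange (f x) (g x) _ _)
  where
  +-interchange : ∀ a b c d → (a + b) + (c + d) ≡ (a + c) + (b + d)
  +-interchange = solve-∀

∑-0 : ∀ (xs : List A) → ∑[ x ∈ xs ] 0 ≡ 0
∑-0 []       = refl
∑-0 (x ∷ xs) = ∑-0 xs

∑-comm : ∀ (xs : List A) (ys : List B) (f : A → B → ℕ) →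
         ∑[ x ∈ xs ] ∑[ y ∈ ys ] f x y ≡ ∑[ y ∈ ys ] ∑[ x ∈ xs ] f x y
∑-comm []       ys f = sym (∑-0 ys)
∑-comm (x ∷ xs) ys f =
  trans (cong (∑ ys (f x) +_) (∑-comm xs ys f)) (sym (∑-+ ys (f x) _))

⟦_⟧ : Bool → ℕ
⟦ true  ⟧ = 1
⟦ false ⟧ = 0

⟦∧⟧ : ∀ a b → ⟦ a ∧ b ⟧ ≡ ⟦ a ⟧ * ⟦ b ⟧
⟦∧⟧ true  b = sym (*-identityˡ ⟦ b ⟧)
⟦∧⟧ false b = refl

∑-filterᵇ : ∀ (p : A → Bool) (xs : List A) (f : A → ℕ) →
            ∑ (filterᵇ p xs) f ≡ ∑[ x ∈ xs ] ⟦ p x ⟧ * f x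
∑-filterᵇ p []       f = refl
∑-filterᵇ p (x ∷ xs) f with p x
... | true  = cong₂ _+_ (sym (+-identityʳ (f x))) (∑-filterᵇ p xs f)
... | false = ∑-filterᵇ p xs f

length-filterᵇ : ∀ (p : A → Bool) (xs : List A) → length (filterᵇ p xs) ≡ ∑[ x ∈ xs ] ⟦ p x ⟧
length-filterᵇ p []       = refl
length-filterᵇ p (x ∷ xs) with p x
... | true  = cong suc (length-filterᵇ p xs)
... | false = length-filterᵇ p xs

∑-allVecs : ∀ k (f : Vec Dir (suc k) → ℕ) →
            ∑ (allVecs (suc k)) f ≡ ∑[ x ∈ allDirs ] ∑[ v ∈ allVecs k ] f (x ∷ v)
∑-allVecs k f =
  trans (∑-concatMap (λ x → map (x ∷_) (allVecs k)) allDirs f)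
        (∑-cong allDirs (λ x → ∑-map (x ∷_) (allVecs k) f))

∑-allVecs² : ∀ k l (f : Vec Dir (suc k) → Vec Dir (suc l) → ℕ) →
             ∑[ t ∈ allVecs (suc k) ] ∑[ b ∈ allVecs (suc l) ] f t b
             ≡ ∑[ x ∈ allDirs ] ∑[ y ∈ allDirs ] ∑[ t ∈ allVecs k ] ∑[ b ∈ allVecs l ] f (x ∷ t) (y ∷ b)
∑-allVecs² k l f =
  trans (∑-allVecs k (λ t → ∑[ b ∈ allVecs (suc l) ] f t b))
        (∑-cong allDirs λ x →
          trans (∑-cong (allVecs k) (λ t → ∑-allVecs l (f (x ∷ t))))
                (∑-comm (allVecs k) allDirs (λ t y → ∑[ b ∈ allVecs l ] f (x ∷ t) (y ∷ b))))

checkRow-shift : ∀ {f g : ℕ → Dir → Bool} i₀ → (∀ i d → i₀ ≤ i → f (suc i) d ≡ g i d) →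
                 (r : Vec Dir n) → checkRow f (suc i₀) r ≡ checkRow g i₀ r
checkRow-shift i₀ f≡g []      = refl
checkRow-shift i₀ f≡g (d ∷ r) =
  cong₂ _∧_ (f≡g i₀ d ≤-refl)
            (checkRow-shift (suc i₀) (λ i d i₀<i → f≡g i d (≤-trans (n≤1+n i₀) i₀<i)) r)

-- A domino entering from the left is modelled by an extra first column whose cell points right
-- (and a unit square when no domino enters), so that isTiling can be used unchanged.
boundary : Bool → Dir
boundary false = sq
boundary true  = rt

extend : Bool → Bool → Vec Dir k × Vec Dir l → Vec Dir (suc k) × Vec Dir (suc l)
extend P Q (t , b) = boundary P ∷ t , boundary Q ∷ b

topCell : Bool → Dir → Dir → Bool
topCell true  x  _ = x == lt
topCell false sq _ = true
topCell false rt _ = true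
topCell false lt _ = false
topCell false up _ = false
topCell false dn y = y == up

bottomCell : Bool → Dir → Dir → Bool
bottomCell true  _ y  = y == lt
bottomCell false _ sq = true
bottomCell false _ rt = true
bottomCell false _ lt = false
bottomCell false x up = x == dn
bottomCell false _ dn = false

columnOK : Bool → Bool → Dir → Dir → Bool
columnOK P Q x y = topCell P x y ∧ bottomCell Q x y

topOK-sq∷ : ∀ c (t : Vec Dir k) (b : Vec Dir l) i d → topOK (sq ∷ t) (c ∷ b) (suc i) d ≡ topOK t b i d
topOK-sq∷ c t b i       sq = refl
topOK-sq∷ c t b i       rt = refl
topOK-sq∷ c t b zero    lt = refl
topOK-sq∷ c t b (suc i) lt = refl
topOK-sq∷ c t b i       up = refl
topOK-sq∷ c t b i       dn = refl

botOK-sq∷ : ∀ a (t : Vec Dir k) (b : Vec Dir l) i d → botOK (a ∷ t) (sq ∷ b) (suc i) d ≡ botOK t b i d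
botOK-sq∷ a t b i       sq = refl
botOK-sq∷ a t b i       rt = refl
botOK-sq∷ a t b zero    lt = refl
botOK-sq∷ a t b (suc i) lt = refl
botOK-sq∷ a t b i       up = refl
botOK-sq∷ a t b i       dn = refl

isTiling-sq∷ : ∀ (t : Vec Dir k) (b : Vec Dir l) → isTiling (sq ∷ t , sq ∷ b) ≡ isTiling (t , b)
isTiling-sq∷ t b =
  cong₂ _∧_ (checkRow-shift 0 (λ i d _ → topOK-sq∷ sq t b i d) t)
            (checkRow-shift 0 (λ i d _ → botOK-sq∷ sq t b i d) b)

topOK-peel : ∀ a c x y (t : Vec Dir k) (b : Vec Dir l) i d →
             topOK (a ∷ x ∷ t) (c ∷ y ∷ b) (suc (suc i)) d
             ≡ topOK (boundary (x == rt) ∷ t) (boundary (y == rt) ∷ b) (suc i) d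
topOK-peel a c x  y t b i       sq = refl
topOK-peel a c x  y t b i       rt = refl
topOK-peel a c sq y t b zero    lt = refl
topOK-peel a c rt y t b zero    lt = refl
topOK-peel a c lt y t b zero    lt = refl
topOK-peel a c up y t b zero    lt = refl
topOK-peel a c dn y t b zero    lt = refl
topOK-peel a c x  y t b (suc i) lt = refl
topOK-peel a c x  y t b i       up = refl
topOK-peel a c x  y t b i       dn = refl

botOK-peel : ∀ a c x y (t : Vec Dir k) (b : Vec Dir l) i d →
                botOK (a ∷ x ∷ t) (c ∷ y ∷ b) (suc (suc i)) d
                ≡ botOK (boundary (x == rt) ∷ t) (boundary (y == rt) ∷ b) (suc i) d
botOK-peel a c x y  t b i       sq = refl
botOK-peel a c x y  t b i       rt = refl
botOK-peel a c x sq t b zero    lt = refl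
botOK-peel a c x rt t b zero    lt = refl
botOK-peel a c x lt t b zero    lt = refl
botOK-peel a c x up t b zero    lt = refl
botOK-peel a c x dn t b zero    lt = refl
botOK-peel a c x y  t b (suc i) lt = refl
botOK-peel a c x y  t b i       up = refl
botOK-peel a c x y  t b i       dn = refl

topRow-peel : ∀ P c x y (t : Vec Dir k) (b : Vec Dir l) →
              let t′ = boundary (x == rt) ∷ t ; b′ = boundary (y == rt) ∷ b in
              checkRow (topOK (boundary P ∷ x ∷ t) (c ∷ y ∷ b)) 0 (boundary P ∷ x ∷ t)
              ≡ topCell P x y ∧ checkRow (topOK t′ b′) 0 t′
topRow-peel {k} {l} P c x y t b =
  trans (cong (λ R → topOK u v 0 (boundary P) ∧ (topOK u v 1 x ∧ R)) (checkRow-shift 1 shift t))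
        (firstColumns P x)
  where
  u : Vec Dir (2 + k)
  u = boundary P ∷ x ∷ t
  v : Vec Dir (2 + l)
  v = c ∷ y ∷ b
  t′ : Vec Dir (suc k)
  t′ = boundary (x == rt) ∷ t
  b′ : Vec Dir (suc l)
  b′ = boundary (y == rt) ∷ b

  shift : ∀ i d → 1 ≤ i → topOK u v (suc i) d ≡ topOK t′ b′ i d
  shift (suc i) d _ = topOK-peel (boundary P) c x y t b i d

  firstColumns : ∀ P x {R} →
                 topOK (boundary P ∷ x ∷ t) v 0 (boundary P) ∧ (topOK (boundary P ∷ x ∷ t) v 1 x ∧ R)
                 ≡ topCell P x y ∧ (topOK (boundary (x == rt) ∷ t) b′ 0 (boundary (x == rt)) ∧ R)
  firstColumns true  sq = refl
  firstColumns true  rt = refl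
  firstColumns true  lt = refl
  firstColumns true  up = refl
  firstColumns true  dn = refl
  firstColumns false sq = refl
  firstColumns false rt = refl
  firstColumns false lt = refl
  firstColumns false up = refl
  firstColumns false dn = refl

botRow-peel : ∀ Q a x y (t : Vec Dir k) (b : Vec Dir l) →
              let t′ = boundary (x == rt) ∷ t ; b′ = boundary (y == rt) ∷ b in
              checkRow (botOK (a ∷ x ∷ t) (boundary Q ∷ y ∷ b)) 0 (boundary Q ∷ y ∷ b)
              ≡ bottomCell Q x y ∧ checkRow (botOK t′ b′) 0 b′
botRow-peel {k} {l} Q a x y t b =
  trans (cong (λ R → botOK u v 0 (boundary Q) ∧ (botOK u v 1 y ∧ R)) (checkRow-shift 1 shift b))
        (firstColumns Q y)
  where
  u : Vec Dir (2 + k)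
  u = a ∷ x ∷ t
  v : Vec Dir (2 + l)
  v = boundary Q ∷ y ∷ b
  t′ : Vec Dir (suc k)
  t′ = boundary (x == rt) ∷ t
  b′ : Vec Dir (suc l)
  b′ = boundary (y == rt) ∷ b

  shift : ∀ i d → 1 ≤ i → botOK u v (suc i) d ≡ botOK t′ b′ i d
  shift (suc i) d _ = botOK-peel a (boundary Q) x y t b i d

  firstColumns : ∀ Q y {R} →
                 botOK u (boundary Q ∷ y ∷ b) 0 (boundary Q) ∧ (botOK u (boundary Q ∷ y ∷ b) 1 y ∧ R)
                 ≡ bottomCell Q x y ∧ (botOK t′ (boundary (y == rt) ∷ b) 0 (boundary (y == rt)) ∧ R)
  firstColumns true  sq = refl
  firstColumns true  rt = refl
  firstColumns true  lt = refl
  firstColumns true  up = refl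
  firstColumns true  dn = refl
  firstColumns false sq = refl
  firstColumns false rt = refl
  firstColumns false lt = refl
  firstColumns false up = refl
  firstColumns false dn = refl

isTiling-peel : ∀ P Q x y (t : Vec Dir k) (b : Vec Dir l) →
                isTiling (extend P Q (x ∷ t , y ∷ b))
                ≡ columnOK P Q x y ∧ isTiling (extend (x == rt) (y == rt) (t , b))
isTiling-peel P Q x y t b =
  trans (cong₂ _∧_ (topRow-peel P (boundary Q) x y t b) (botRow-peel Q (boundary P) x y t b))
        (interchange (topCell P x y) _ (bottomCell Q x y) _)

boards : ∀ m → List (Vec Dir (suc m) × Vec Dir m)
boards m = cartesianProduct (allVecs (suc m)) (allVecs m)

tilings : Bool → Bool → ℕ → ℕ
tilings P Q m = length (filterᵇ (isTiling ∘ extend P Q) (boards m))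

tilings-∑ : ∀ P Q m →
            tilings P Q m ≡ ∑[ t ∈ allVecs (suc m) ] ∑[ b ∈ allVecs m ] ⟦ isTiling (extend P Q (t , b)) ⟧
tilings-∑ P Q m =
  trans (length-filterᵇ (isTiling ∘ extend P Q) (boards m))
        (∑-cartesianProduct (allVecs (suc m)) (allVecs m) (λ tb → ⟦ isTiling (extend P Q tb) ⟧))

c≡tilings-false-false : ∀ m → c (suc m) ≡ tilings false false m
c≡tilings-false-false m =
  trans (length-filterᵇ isTiling (boards m))
        (trans (∑-cong (boards m) (λ (t , b) → cong ⟦_⟧ (sym (isTiling-sq∷ t b))))
               (sym (length-filterᵇ (isTiling ∘ extend false false) (boards m))))

admissibleColumns : Bool → Bool → List (Dir × Dir)
admissibleColumns P Q = filterᵇ (uncurry (columnOK P Q)) (cartesianProduct allDirs allDirs)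

tilings-transfer : ∀ P Q m →
                   tilings P Q (suc m) ≡ ∑[ (x , y) ∈ admissibleColumns P Q ] tilings (x == rt) (y == rt) m
tilings-transfer P Q m = begin
  tilings P Q (suc m)
    ≡⟨ tilings-∑ P Q (suc m) ⟩
  ∑[ t ∈ allVecs (2 + m) ] ∑[ b ∈ allVecs (suc m) ] ⟦ isTiling (extend P Q (t , b)) ⟧
    ≡⟨ ∑-allVecs² (suc m) m (λ t b → ⟦ isTiling (extend P Q (t , b)) ⟧) ⟩
  ∑[ x ∈ allDirs ] ∑[ y ∈ allDirs ]
    ∑[ t ∈ allVecs (suc m) ] ∑[ b ∈ allVecs m ] ⟦ isTiling (extend P Q (x ∷ t , y ∷ b)) ⟧
    ≡⟨ ∑-cong allDirs (λ x → ∑-cong allDirs (λ y → firstColumn x y)) ⟩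
  ∑[ x ∈ allDirs ] ∑[ y ∈ allDirs ] ⟦ columnOK P Q x y ⟧ * tilings (x == rt) (y == rt) m
    ≡⟨ sym (∑-cartesianProduct allDirs allDirs
             (λ (x , y) → ⟦ columnOK P Q x y ⟧ * tilings (x == rt) (y == rt) m)) ⟩
  ∑[ (x , y) ∈ cartesianProduct allDirs allDirs ] ⟦ columnOK P Q x y ⟧ * tilings (x == rt) (y == rt) m
    ≡⟨ sym (∑-filterᵇ (uncurry (columnOK P Q)) _ (λ (x , y) → tilings (x == rt) (y == rt) m)) ⟩
  ∑[ (x , y) ∈ admissibleColumns P Q ] tilings (x == rt) (y == rt) m ∎
  where
  open ≡-Reasoning

  firstColumn : ∀ x y →
                ∑[ t ∈ allVecs (suc m) ] ∑[ b ∈ allVecs m ] ⟦ isTiling (extend P Q (x ∷ t , y ∷ b)) ⟧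
                ≡ ⟦ columnOK P Q x y ⟧ * tilings (x == rt) (y == rt) m
  firstColumn x y = begin
    ∑[ t ∈ allVecs (suc m) ] ∑[ b ∈ allVecs m ] ⟦ isTiling (extend P Q (x ∷ t , y ∷ b)) ⟧
      ≡⟨ ∑-cong (allVecs (suc m)) (λ t → ∑-cong (allVecs m) (λ b →
           trans (cong ⟦_⟧ (isTiling-peel P Q x y t b)) (⟦∧⟧ (columnOK P Q x y) _))) ⟩
    ∑[ t ∈ allVecs (suc m) ] ∑[ b ∈ allVecs m ] w * rest t b
      ≡⟨ ∑-cong (allVecs (suc m)) (λ t → ∑-*ˡ (allVecs m) w (rest t)) ⟩
    ∑[ t ∈ allVecs (suc m) ] w * ∑ (allVecs m) (rest t)
      ≡⟨ ∑-*ˡ (allVecs (suc m)) w (λ t → ∑ (allVecs m) (rest t)) ⟩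
    w * (∑[ t ∈ allVecs (suc m) ] ∑ (allVecs m) (rest t))
      ≡⟨ cong (w *_) (sym (tilings-∑ (x == rt) (y == rt) m)) ⟩
    w * tilings (x == rt) (y == rt) m ∎
    where
    w : ℕ
    w = ⟦ columnOK P Q x y ⟧
    rest : Vec Dir (suc m) → Vec Dir m → ℕ
    rest t b = ⟦ isTiling (extend (x == rt) (y == rt) (t , b)) ⟧

tilings-ff-suc : ∀ m → tilings false false (suc m)
                       ≡ 2 * tilings false false m + tilings true false m + tilings false true m + tilings true true m
tilings-ff-suc m =
  trans (tilings-transfer false false m)
        (reorder (tilings false false m) (tilings true false m) (tilings false true m) (tilings true true m))
  where
  reorder : ∀ a b d e → a + (d + (b + (e + (a + 0)))) ≡ 2 * a + b + d + e
  reorder = solve-∀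

tilings-tf-suc : ∀ m → tilings true false (suc m) ≡ tilings false false m + tilings false true m
tilings-tf-suc m = trans (tilings-transfer true false m) (cong (tilings false false m +_) (+-identityʳ _))

tilings-ft-suc : ∀ m → tilings false true (suc m) ≡ tilings false false m + tilings true false m
tilings-ft-suc m = trans (tilings-transfer false true m) (cong (tilings false false m +_) (+-identityʳ _))

tilings-tt-suc : ∀ m → tilings true true (suc m) ≡ tilings false false m
tilings-tt-suc m = trans (tilings-transfer true true m) (+-identityʳ _)

c≡tilings-true-true : ∀ m → c m ≡ tilings true true m
c≡tilings-true-true zero    = refl
c≡tilings-true-true (suc m) = trans (c≡tilings-false-false m) (sym (tilings-tt-suc m))

transfer-eliminate : ∀ {a₀ b₀ d₀ e₀ a₁ b₁ d₁ e₁ a₂} →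
                     a₁ ≡ 2 * a₀ + b₀ + d₀ + e₀ → b₁ ≡ a₀ + d₀ → d₁ ≡ a₀ + b₀ → e₁ ≡ a₀ →
                     a₂ ≡ 2 * a₁ + b₁ + d₁ + e₁ → a₂ + e₀ ≡ 3 * a₁ + a₀
transfer-eliminate {a₀} {b₀} {d₀} {e₀} refl refl refl refl refl = identity a₀ b₀ d₀ e₀
  where
  identity : ∀ a b d e → let a₁ = 2 * a + b + d + e in
             2 * a₁ + (a + d) + (a + b) + a + e ≡ 3 * a₁ + a
  identity = solve-∀

tilings-recurrence : ∀ m → tilings false false (2 + m) + tilings true true m
                           ≡ 3 * tilings false false (suc m) + tilings false false m
tilings-recurrence m =
  transfer-eliminate (tilings-ff-suc m) (tilings-tf-suc m) (tilings-ft-suc m) (tilings-tt-suc m)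
                     (tilings-ff-suc (suc m))

lemma3 : (n : ℕ) → 3 ≤ n → c n + c (n ∸ 3) ≡ 3 * c (n ∸ 1) + c (n ∸ 2)
lemma3 (suc zero)          (s≤s ())
lemma3 (suc (suc zero))    (s≤s (s≤s ()))
lemma3 (suc (suc (suc m))) _ = begin
  c (3 + m) + c m
    ≡⟨ cong₂ _+_ (c≡tilings-false-false (2 + m)) (c≡tilings-true-true m) ⟩
  tilings false false (2 + m) + tilings true true m
    ≡⟨ tilings-recurrence m ⟩
  3 * tilings false false (suc m) + tilings false false m
    ≡⟨ sym (cong₂ _+_ (cong (3 *_) (c≡tilings-false-false (suc m))) (c≡tilings-false-false m)) ⟩
  3 * c (2 + m) + c (suc m) ∎
  where open ≡-Reasoning
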